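{- Let $(G,k)$, $\eta$, $X$, $Z$ be as in the context, let $P_0=X\cup Z$, and let $G_{\mathrm{flow}}$ be the graph obtained from $G$ by adding every edge $uv$ with $u,v\in P_0$ such that there are at least $k+\eta+2$ internally vertex-disjoint $u$–$v$ paths in $G$. Then (1) $\mathrm{opt}_{\mathrm{Tw}}((G,k))=\mathrm{opt}_{\mathrm{Tw}}((G_{\mathrm{flow}},k))$, and (2) $\mathrm{opt}_{\mathcal{F}}((G,k))\ge\mathrm{opt}_{\mathrm{Tw}}((G_{\mathrm{flow}},k))$.
   Context: $\mathcal{F}$ is a finite family of graphs containing a planar graph, and $\eta$ is an integer such that every $\mathcal{F}$-minor-free graph has treewidth at most $\eta$. $X,Z\subseteq V(G)$ are disjoint, $|X|=\mathcal{O}_\eta(k)$, $|Z|=\mathcal{O}_\eta(k^3)$, $X$ is an $\mathcal{F}$-deletion set of $G$ (i.e. $G-X$ has no minor in $\mathcal{F}$), each component $C$ of $G-(X\cup Z)$ has $|N_G(C)\cap Z|\le 2(\eta+1)$, and for distinct $u,v\in N_G(C)\cap X$ there are at least $k+\eta+2$ vertex-disjoint $u$–$v$ paths in $G$. For an instance $(H,k)$: $\mathrm{opt}_{\mathcal{F}}((H,k))$ is the minimum of $\min\{|S|,k+1\}$ over $\mathcal{F}$-deletion sets $S$ of $H$, and $\mathrm{opt}_{\mathrm{Tw}}((H,k))$ is the minimum of $\min\{|S|,k+1\}$ over sets $S$ with $\mathrm{tw}(H-S)\le\eta$. -}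

module Defs where

open import Level using (Level)
open import Data.Nat using (ℕ; zero; suc; _+_; _*_; _^_; _≤_; _<_; _⊓_)
open import Data.Fin using (Fin; toℕ)
open import Data.Fin.Subset using (Subset; _∈_; _∉_; _⊆_; ∁; ⊤; Nonempty; ∣_∣)
open import Data.List using (List; []; _∷_; length)
open import Data.List.Relation.Unary.All using (All)
open import Data.List.Relation.Unary.Unique.Propositional using (Unique)
import Data.List.Membership.Propositional as LM
open import Data.Product using (Σ; ∃; ∃₂; _×_; _,_)
open import Data.Sum using (_⊎_; inj₁; inj₂)
open import Data.Empty using (⊥)
open import Relation.Nullary using (¬_)
open import Relation.Binary.PropositionalEquality using (_≡_; _≢_; refl; sym)

record Graph (n : ℕ) : Set₁ where
  field
    E      : Fin n → Fin n → Set
    E-sym  : ∀ {u v} → E u v → E v u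
    E-irr  : ∀ {u} → ¬ E u u
open Graph public

data Walk {n : ℕ} (G : Graph n) (P : Fin n → Set) : Fin n → Fin n → Set where
  here : ∀ {u} → P u → Walk G P u u
  step : ∀ {u w v} → P u → E G u w → Walk G P w v → Walk G P u v

Connected : {n : ℕ} → Graph n → (Fin n → Set) → Set
Connected G P = ∀ u v → P u → P v → Walk G P u v

-- Paths as vertex lists: PathFromTo G u v p means p = u … v with
-- consecutive vertices adjacent.  A (simple) path additionally has Unique p.

data PathFromTo {n : ℕ} (G : Graph n) : Fin n → Fin n → List (Fin n) → Set where
  single : ∀ {u} → PathFromTo G u u (u ∷ [])
  cons   : ∀ {u w v p} → E G u w → PathFromTo G w v p → PathFromTo G u v (u ∷ p)

DisjPaths : {n : ℕ} → Graph n → ℕ → Fin n → Fin n → Set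
DisjPaths {n} G m u v =
  Σ (Fin m → List (Fin n)) λ ps →
    (∀ i → PathFromTo G u v (ps i) × Unique (ps i)) ×
    (∀ i j → i ≢ j → ps i ≢ ps j) ×
    (∀ i j → i ≢ j → ∀ x → x LM.∈ ps i → x LM.∈ ps j → (x ≡ u) ⊎ (x ≡ v))

record MinorModel {m n : ℕ} (H : Graph m) (G : Graph n) (A : Subset n) : Set where
  field
    branch    : Fin m → Subset n
    nonempty  : ∀ i → Nonempty (branch i)
    inside    : ∀ i → branch i ⊆ A
    disjoint  : ∀ i j → i ≢ j → ∀ x → x ∈ branch i → x ∈ branch j → ⊥
    connected : ∀ i → Connected G (λ x → x ∈ branch i)
    edges     : ∀ i j → E H i j →
                ∃₂ λ x y → x ∈ branch i × y ∈ branch j × E G x y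

Family : Set₁
Family = List (Σ ℕ Graph)

MinorFree : {n : ℕ} → Family → Graph n → Subset n → Set₁
MinorFree F G A = All (λ mH → ¬ MinorModel (Data.Product.proj₂ mH) G A) F

FDeletion : {n : ℕ} → Family → Graph n → Subset n → Set₁
FDeletion F G S = MinorFree F G (∁ S)

-- Planarity (via Wagner's theorem: no K₅ and no K₃,₃ minor).

K5 : Graph 5
K5 = record { E = λ i j → i ≢ j ; E-sym = λ p q → p (sym q) ; E-irr = λ p → p refl }

side : Fin 6 → Set
side i = toℕ i < 3

K33 : Graph 6
K33 = record
  { E = λ i j → (side i × ¬ side j) ⊎ (¬ side i × side j)
  ; E-sym = λ { (inj₁ (a , b)) → inj₂ (b , a) ; (inj₂ (a , b)) → inj₁ (b , a) }
  ; E-irr = λ { (inj₁ (a , b)) → b a ; (inj₂ (a , b)) → a b }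
  }

Planar : {n : ℕ} → Graph n → Set
Planar G = ¬ MinorModel K5 G ⊤ × ¬ MinorModel K33 G ⊤

IsTree : {t : ℕ} → Graph t → Set
IsTree {t} T =
  1 ≤ t ×
  Connected T (λ _ → Data.Unit.⊤) ×
  ¬ (∃₂ λ u v → ∃ λ p → PathFromTo T u v p × Unique p × 3 ≤ length p × E T v u)
  where import Data.Unit

record TreeDec {n : ℕ} (G : Graph n) (A : Subset n) (w : ℕ) : Set₁ where
  field
    t         : ℕ
    T         : Graph t
    tree      : IsTree T
    bag       : Fin t → Subset n
    bagInside : ∀ i → bag i ⊆ A
    width     : ∀ i → ∣ bag i ∣ ≤ suc w
    vcover    : ∀ v → v ∈ A → ∃ λ i → v ∈ bag i
    ecover    : ∀ u v → u ∈ A → v ∈ A → E G u v → ∃ λ i → u ∈ bag i × v ∈ bag i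
    coherent  : ∀ v → Connected T (λ i → v ∈ bag i)

TwDeletion : {n : ℕ} → ℕ → Graph n → Subset n → Set₁
TwDeletion η G S = TreeDec G (∁ S) η

IsOpt : {ℓ : Level} {n : ℕ} → (Subset n → Set ℓ) → ℕ → ℕ → Set ℓ
IsOpt P k o =
  (∃ λ S → P S × o ≡ ∣ S ∣ ⊓ suc k) × (∀ S → P S → o ≤ ∣ S ∣ ⊓ suc k)

Component : {n : ℕ} → Graph n → Subset n → Subset n → Set
Component G P C =
  Nonempty C × C ⊆ ∁ P × Connected G (λ x → x ∈ C) ×
  (∀ u v → u ∈ C → v ∉ P → E G u v → v ∈ C)

InNbr : {n : ℕ} → Graph n → Subset n → Fin n → Set
InNbr G C v = v ∉ C × ∃ λ u → u ∈ C × E G u v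

-- Fix S with |S| ≤ k and a tree decomposition of G − S of width η.  If two
-- vertices u, v of G − S shared no bag, some tree edge a₀a₁ would separate the
-- bags of u from those of v; every u–v path then meets S or the adhesion
-- bag a₀ ∩ bag a₁, so k + η + 2 internally disjoint u–v paths need
-- k + η + 2 ≤ |S| + |bag a₀| ≤ k + η + 1 internal vertices there.  Hence the
-- decomposition already covers every flow edge, so treewidth-η deletion sets
-- of size at most k are the same in G and G_flow, while larger sets are
-- capped at k + 1 in both optima.  An F-deletion set is a treewidth-η
-- deletion set by the choice of η.
module Submission where

open import Defs
open import Data.Nat using (ℕ; zero; suc; _+_; _*_; _^_; _≤_; _⊓_; z≤n; s≤s)
open import Data.Nat.Properties
  using (≤-trans; ≤-antisym; ≤-reflexive; +-monoʳ-≤; +-suc; +-comm; +-mono-≤; n≤1+n; 1+n≰n; _≤?_; ≰⇒>; m⊓n≤n; m≥n⇒m⊓n≡n; module ≤-Reasoning)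
open import Data.Fin using (Fin; zero; suc; _≟_)
open import Data.Fin.Properties using (suc-injective; 0≢1+n; any?)
open import Data.Fin.Subset using (Subset; _∈_; _∉_; _⊆_; _∪_; _-_; ∁; ⊤; ∣_∣; inside; outside)
open import Data.Fin.Subset.Properties
  using (_∈?_; ∈⊤; x∈p∪q⁺; x∉∁p⇒x∈p; x∈∁p⇒x∉p; x∉p⇒x∈∁p; x∈p∧x≢y⇒x∈p-y; x∈p⇒∣p-x∣<∣p∣)
open import Data.Vec using (_∷_; []; here; there)
open import Data.List using ([]; _∷_; length)
open import Data.List.Relation.Unary.Any using (Any)
import Data.List.Relation.Unary.Any as Any
open import Data.List.Relation.Unary.All using (All; []; _∷_)
import Data.List.Relation.Unary.All as All
open import Data.List.Relation.Unary.All.Properties using (¬Any⇒All¬)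
open import Data.List.Relation.Unary.AllPairs.Core using ([]; _∷_)
open import Data.List.Relation.Unary.Unique.Propositional using (Unique)
open import Data.List.Membership.Propositional using (find) renaming (_∈_ to _∈ˡ_)
import Data.List.Membership.DecPropositional as DecMembership
open import Data.Product using (∃; ∃₂; _×_; _,_; proj₁; proj₂)
open import Data.Sum using (_⊎_; inj₁; inj₂)
open import Data.Empty using (⊥; ⊥-elim)
open import Data.Unit using (tt) renaming (⊤ to Unit)
open import Function.Definitions using (Injective)
open import Relation.Nullary using (¬_; yes; no; Dec)
open import Relation.Nullary.Decidable using (_×-dec_; _⊎-dec_)
open import Relation.Binary.PropositionalEquality using (_≡_; _≢_; refl; sym; subst; subst₂; cong)

Reachable : {n : ℕ} → Graph n → Fin n → Fin n → Set
Reachable G = Walk G (λ _ → Unit)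

module _ {n : ℕ} {G : Graph n} {P : Fin n → Set} where

  walk-source : ∀ {a b} → Walk G P a b → P a
  walk-source (here p)     = p
  walk-source (step p _ _) = p

  infixr 5 _++ʷ_
  _++ʷ_ : ∀ {a b c} → Walk G P a b → Walk G P b c → Walk G P a c
  here _     ++ʷ w′ = w′
  step p e w ++ʷ w′ = step p e (w ++ʷ w′)

  walk-snoc : ∀ {a b c} → Walk G P a b → E G b c → P c → Walk G P a c
  walk-snoc (here p)     e pc = step p e (here pc)
  walk-snoc (step p e w) e′ pc = step p e (walk-snoc w e′ pc)

  walk-reverse : ∀ {a b} → Walk G P a b → Walk G P b a
  walk-reverse (here p)     = here p
  walk-reverse (step p e w) = walk-snoc (walk-reverse w) (E-sym G e) p

  walk-forget : ∀ {a b} → Walk G P a b → Reachable G a b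
  walk-forget (here _)     = here tt
  walk-forget (step _ e w) = step tt e (walk-forget w)

  walk-last-exit : {R : Fin n → Set} → (∀ i → Dec (R i)) → ∀ {a b} → Walk G P a b → ¬ R b →
    Walk G (λ i → ¬ R i) a b ⊎ (∃₂ λ a₀ a₁ → R a₀ × E G a₀ a₁ × Walk G (λ i → ¬ R i) a₁ b)
  walk-last-exit R? (here _) ¬Rb = inj₁ (here ¬Rb)
  walk-last-exit R? {a} (step _ e w) ¬Rb with walk-last-exit R? w ¬Rb
  ... | inj₂ exit = inj₂ exit
  ... | inj₁ w′ with R? a
  ...   | yes Ra = inj₂ (_ , _ , Ra , e , w′)
  ...   | no ¬Ra = inj₁ (step ¬Ra e w′)

walk-map : ∀ {m n} {G : Graph m} {H : Graph n} {P : Fin m → Set} {Q : Fin n → Set}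
  (f : Fin m → Fin n) → (∀ {x y} → P x → P y → E G x y → E H (f x) (f y)) → (∀ {x} → P x → Q (f x)) →
  ∀ {a b} → Walk G P a b → Walk H Q (f a) (f b)
walk-map f f-edge f-pred (here p)     = here (f-pred p)
walk-map f f-edge f-pred (step p e w) =
  step (f-pred p) (f-edge p (walk-source w) e) (walk-map f f-edge f-pred w)

path-suffix : ∀ {n} {G : Graph n} {x u v p} → x ∈ˡ p → PathFromTo G u v p → Unique p →
  ∃ λ q → PathFromTo G x v q × Unique q
path-suffix (Any.here refl) single        unique       = _ , single , unique
path-suffix (Any.here refl) (cons e path) unique       = _ , cons e path , unique
path-suffix (Any.there x∈p) (cons _ path) (_ ∷ unique) = path-suffix x∈p path unique

walk⇒path : ∀ {n} {G : Graph n} {P : Fin n → Set} {a b} → Walk G P a b →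
  ∃ λ q → PathFromTo G a b q × Unique q
walk⇒path (here _) = _ , single , [] ∷ []
walk⇒path {a = a} (step _ e w) with walk⇒path w
... | q , path , unique with DecMembership._∈?_ _≟_ a q
...   | yes a∈q = path-suffix a∈q path unique
...   | no  a∉q = a ∷ q , cons e path , ¬Any⇒All¬ q a∉q ∷ unique

path-map : ∀ {n} {G H : Graph n} → (∀ {x y} → E G x y → E H x y) →
  ∀ {a b p} → PathFromTo G a b p → PathFromTo H a b p
path-map f single          = single
path-map f (cons e path)   = cons (f e) (path-map f path)

path-head : ∀ {n} {G : Graph n} {Q : Fin n → Set} {u v p} → PathFromTo G u v p → All Q p → Q u
path-head single     (Qu ∷ _) = Qu
path-head (cons _ _) (Qu ∷ _) = Qu

∣p∪q∣≤∣p∣+∣q∣ : ∀ {n} (p q : Subset n) → ∣ p ∪ q ∣ ≤ ∣ p ∣ + ∣ q ∣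
∣p∪q∣≤∣p∣+∣q∣ []            []            = z≤n
∣p∪q∣≤∣p∣+∣q∣ (outside ∷ p) (outside ∷ q) = ∣p∪q∣≤∣p∣+∣q∣ p q
∣p∪q∣≤∣p∣+∣q∣ (inside ∷ p)  (outside ∷ q) = s≤s (∣p∪q∣≤∣p∣+∣q∣ p q)
∣p∪q∣≤∣p∣+∣q∣ (outside ∷ p) (inside ∷ q)  = ≤-trans (s≤s (∣p∪q∣≤∣p∣+∣q∣ p q)) (≤-reflexive (sym (+-suc ∣ p ∣ ∣ q ∣)))
∣p∪q∣≤∣p∣+∣q∣ (inside ∷ p)  (inside ∷ q)  = s≤s (≤-trans (∣p∪q∣≤∣p∣+∣q∣ p q) (+-monoʳ-≤ ∣ p ∣ (n≤1+n ∣ q ∣)))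

injection⇒≤∣p∣ : ∀ {n} m (f : Fin m → Fin n) (p : Subset n) → Injective _≡_ _≡_ f → (∀ i → f i ∈ p) → m ≤ ∣ p ∣
injection⇒≤∣p∣ zero    f p f-inj f∈p = z≤n
injection⇒≤∣p∣ (suc m) f p f-inj f∈p =
  ≤-trans (s≤s (injection⇒≤∣p∣ m (λ i → f (suc i)) (p - f zero) (λ eq → suc-injective (f-inj eq))
                  (λ i → x∈p∧x≢y⇒x∈p-y (f∈p (suc i)) (λ eq → 0≢1+n (f-inj (sym eq))))))
          (x∈p⇒∣p-x∣<∣p∣ (f∈p zero))

disjointPaths-hitting-set : ∀ {n} {G : Graph n} {m u v} (paths : DisjPaths G m u v) (W : Subset n) →
  (∀ i → Any (λ z → z ∈ W × z ≢ u × z ≢ v) (proj₁ paths i)) → m ≤ ∣ W ∣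
disjointPaths-hitting-set {m = m} {u} {v} (ps , _ , _ , disjoint) W hit =
  injection⇒≤∣p∣ m hitter W hitter-injective (λ i → proj₁ (hit-props i))
  where
  hitter : Fin m → Fin _
  hitter i = proj₁ (find (hit i))
  on-path : ∀ i → hitter i ∈ˡ ps i
  on-path i = proj₁ (proj₂ (find (hit i)))
  hit-props : ∀ i → hitter i ∈ W × hitter i ≢ u × hitter i ≢ v
  hit-props i = proj₂ (proj₂ (find (hit i)))
  hitter-injective : Injective _≡_ _≡_ hitter
  hitter-injective {i} {j} eq with i ≟ j
  ... | yes i≡j = i≡j
  ... | no i≢j with disjoint i j i≢j (hitter i) (on-path i) (subst (_∈ˡ ps j) (sym eq) (on-path j))
  ...   | inj₁ ≡u = ⊥-elim (proj₁ (proj₂ (hit-props i)) ≡u)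
  ...   | inj₂ ≡v = ⊥-elim (proj₂ (proj₂ (hit-props i)) ≡v)

removeEdge : ∀ {t} → Graph t → Fin t → Fin t → Graph t
removeEdge T a b = record
  { E     = λ x y → E T x y × ¬ (x ≡ a × y ≡ b) × ¬ (x ≡ b × y ≡ a)
  ; E-sym = λ (e , ¬ab , ¬ba) →
      E-sym T e , (λ (y≡a , x≡b) → ¬ba (x≡b , y≡a)) , (λ (y≡b , x≡a) → ¬ab (x≡a , y≡b))
  ; E-irr = λ (e , _) → E-irr T e
  }

walk-avoiding-edge : ∀ {t} {T : Graph t} {R : Fin t → Set} {a b} → ¬ (R a × R b) →
  ∀ {x y} → Walk T R x y → Walk (removeEdge T a b) R x y
walk-avoiding-edge {T = T} {R} {a} {b} ¬both = walk-map (λ x → x) keep-edge (λ r → r)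
  where
  keep-edge : ∀ {x y} → R x → R y → E T x y → E (removeEdge T a b) x y
  keep-edge Rx Ry e = e , (λ { (refl , refl) → ¬both (Rx , Ry) }) , (λ { (refl , refl) → ¬both (Ry , Rx) })

tree-edge-is-bridge : ∀ {t} {T : Graph t} {P : Fin t → Set} {a b} → IsTree T → E T a b →
  ¬ Walk (removeEdge T a b) P a b
tree-edge-is-bridge {T = T} {a = a} {b} (_ , _ , acyclic) e w with walk⇒path w
... | q , path , unique = acyclic (a , b , q , path-map proj₁ path , unique , long path , E-sym T e)
  where
  long : ∀ {p} → PathFromTo (removeEdge T a b) a b p → 3 ≤ length p
  long single                         = ⊥-elim (E-irr T e)
  long (cons (_ , ¬ab , _) single)    = ⊥-elim (¬ab (refl , refl))
  long (cons _ (cons _ single))       = s≤s (s≤s (s≤s z≤n))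
  long (cons _ (cons _ (cons _ _)))   = s≤s (s≤s (s≤s z≤n))

module _ {n : ℕ} {G : Graph n} {A : Subset n} {η : ℕ} (D : TreeDec G A η) where
  open TreeDec D

  bags-along-path : ∀ {a₀ a₁ x y p b} → PathFromTo G x y p →
    All (λ z → z ∈ A × ¬ (z ∈ bag a₀ × z ∈ bag a₁)) p → x ∈ bag b →
    ∃ λ c → y ∈ bag c × Reachable (removeEdge T a₀ a₁) b c
  bags-along-path single _ y∈b = _ , y∈b , here tt
  bags-along-path {x = x} (cons {w = x′} e path) ((x∈A , x∉adhesion) ∷ rest) x∈b
    with ecover x x′ x∈A (proj₁ (path-head path rest)) e
  ... | d , x∈d , x′∈d with bags-along-path path rest x′∈d
  ...   | c , y∈c , d⇝c = c , y∈c , walk-forget (walk-avoiding-edge x∉adhesion (coherent x _ d x∈b x∈d)) ++ʷ d⇝c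

  path-meets-adhesion : ∀ {a₀ a₁ x y p} → E T a₀ a₁ → x ∈ bag a₀ →
    (∀ c → y ∈ bag c → Reachable (removeEdge T a₀ a₁) c a₁) →
    PathFromTo G x y p → Any (λ z → z ∈ ∁ A ⊎ (z ∈ bag a₀ × z ∈ bag a₁)) p
  path-meets-adhesion {a₀} {a₁} {p = p} e x∈a₀ y-beyond path
    with Any.any? (λ z → (z ∈? ∁ A) ⊎-dec ((z ∈? bag a₀) ×-dec (z ∈? bag a₁))) p
  ... | yes meets = meets
  ... | no misses =
    let c , y∈c , a₀⇝c = bags-along-path path (All.map avoids (¬Any⇒All¬ p misses)) x∈a₀
    in ⊥-elim (tree-edge-is-bridge tree e (a₀⇝c ++ʷ y-beyond c y∈c))
    where
    avoids : ∀ {z} → ¬ (z ∈ ∁ A ⊎ (z ∈ bag a₀ × z ∈ bag a₁)) → z ∈ A × ¬ (z ∈ bag a₀ × z ∈ bag a₁)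
    avoids ¬z = x∉∁p⇒x∈p (λ z∉A → ¬z (inj₁ z∉A)) , (λ z∈adhesion → ¬z (inj₂ z∈adhesion))

m+n+2≰m+1+n : ∀ m n → ¬ (m + n + 2 ≤ m + suc n)
m+n+2≰m+1+n m n le = 1+n≰n (begin
  suc (suc (m + n)) ≡⟨ +-comm 2 (m + n) ⟩
  m + n + 2         ≤⟨ le ⟩
  m + suc n         ≡⟨ +-suc m n ⟩
  suc (m + n)       ∎)
  where open ≤-Reasoning

disjointPaths⇒commonBag : ∀ {n} {G : Graph n} {S : Subset n} {k η u v} (D : TreeDec G (∁ S) η) →
  ∣ S ∣ ≤ k → u ∉ S → v ∉ S → DisjPaths G (k + η + 2) u v →
  ∃ λ i → u ∈ TreeDec.bag D i × v ∈ TreeDec.bag D i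
disjointPaths⇒commonBag {S = S} {k} {η} {u} {v} D |S|≤k u∉S v∉S paths
  with any? (λ i → (u ∈? TreeDec.bag D i) ×-dec (v ∈? TreeDec.bag D i))
... | yes common = common
... | no none = ⊥-elim (separated (walk-last-exit (λ i → u ∈? bag i) (connected iu iv tt tt) u∉iv))
  where
  open TreeDec D
  connected : Connected T (λ _ → Unit)
  connected = proj₁ (proj₂ tree)
  iu iv : Fin t
  iu = proj₁ (vcover u (x∉p⇒x∈∁p u∉S))
  iv = proj₁ (vcover v (x∉p⇒x∈∁p v∉S))
  u∈iu : u ∈ bag iu
  u∈iu = proj₂ (vcover u (x∉p⇒x∈∁p u∉S))
  v∈iv : v ∈ bag iv
  v∈iv = proj₂ (vcover v (x∉p⇒x∈∁p v∉S))
  u∉iv : u ∉ bag iv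
  u∉iv u∈iv = none (iv , u∈iv , v∈iv)

  separated : Walk T (λ i → u ∉ bag i) iu iv ⊎
              (∃₂ λ a₀ a₁ → u ∈ bag a₀ × E T a₀ a₁ × Walk T (λ i → u ∉ bag i) a₁ iv) → ⊥
  separated (inj₁ avoiding) = walk-source avoiding u∈iu
  separated (inj₂ (a₀ , a₁ , u∈a₀ , e , a₁⇝iv)) = m+n+2≰m+1+n k η (begin
    k + η + 2            ≤⟨ disjointPaths-hitting-set paths (S ∪ bag a₀) hit ⟩
    ∣ S ∪ bag a₀ ∣        ≤⟨ ∣p∪q∣≤∣p∣+∣q∣ S (bag a₀) ⟩
    ∣ S ∣ + ∣ bag a₀ ∣    ≤⟨ +-mono-≤ |S|≤k (width a₀) ⟩
    k + suc η            ∎)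
    where
    open ≤-Reasoning
    v∉a₀ : v ∉ bag a₀
    v∉a₀ v∈a₀ = none (a₀ , u∈a₀ , v∈a₀)
    v-beyond : ∀ c → v ∈ bag c → Reachable (removeEdge T a₀ a₁) c a₁
    v-beyond c v∈c =
      walk-forget (walk-avoiding-edge (λ (v∈a₀ , _) → v∉a₀ v∈a₀) (coherent v c iv v∈c v∈iv)) ++ʷ
      walk-forget (walk-reverse (walk-avoiding-edge (λ (u∉a₀ , _) → u∉a₀ u∈a₀) a₁⇝iv))
    internal : ∀ {z} → z ∈ ∁ (∁ S) ⊎ (z ∈ bag a₀ × z ∈ bag a₁) → z ∈ S ∪ bag a₀ × z ≢ u × z ≢ v
    internal (inj₁ z∈∁∁S) = let z∈S = x∉∁p⇒x∈p (x∈∁p⇒x∉p z∈∁∁S) in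
      x∈p∪q⁺ (inj₁ z∈S) , (λ { refl → u∉S z∈S }) , (λ { refl → v∉S z∈S })
    internal (inj₂ (z∈a₀ , z∈a₁)) =
      x∈p∪q⁺ (inj₂ z∈a₀) , (λ { refl → walk-source a₁⇝iv z∈a₁ }) , (λ { refl → v∉a₀ z∈a₀ })
    hit : ∀ i → Any (λ z → z ∈ S ∪ bag a₀ × z ≢ u × z ≢ v) (proj₁ paths i)
    hit i = Any.map internal (path-meets-adhesion D e u∈a₀ v-beyond (proj₁ (proj₁ (proj₂ paths) i)))

treeDec-reuse : ∀ {n} {G H : Graph n} {A : Subset n} {η} (D : TreeDec G A η) →
  (∀ u v → u ∈ A → v ∈ A → E H u v → ∃ λ i → u ∈ TreeDec.bag D i × v ∈ TreeDec.bag D i) →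
  TreeDec H A η
treeDec-reuse D cover = record { TreeDec D hiding (ecover) ; ecover = cover }

treeDec-subgraph : ∀ {n} {G H : Graph n} {A : Subset n} {η} → (∀ {u v} → E G u v → E H u v) →
  TreeDec H A η → TreeDec G A η
treeDec-subgraph G⊆H D = treeDec-reuse D (λ u v u∈A v∈A e → TreeDec.ecover D u v u∈A v∈A (G⊆H e))

treeDec-addFlowEdges : ∀ {n} {G H : Graph n} {S : Subset n} {k η} →
  (∀ {u v} → E H u v → E G u v ⊎ DisjPaths G (k + η + 2) u v) → ∣ S ∣ ≤ k →
  TreeDec G (∁ S) η → TreeDec H (∁ S) η
treeDec-addFlowEdges {H = H} {S} H⊆G+flow |S|≤k D = treeDec-reuse D cover
  where
  cover : ∀ u v → u ∈ ∁ S → v ∈ ∁ S → E H u v → ∃ λ i → u ∈ TreeDec.bag D i × v ∈ TreeDec.bag D i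
  cover u v u∈A v∈A e with H⊆G+flow e
  ... | inj₁ eG    = TreeDec.ecover D u v u∈A v∈A eG
  ... | inj₂ paths = disjointPaths⇒commonBag D |S|≤k (x∈∁p⇒x∉p u∈A) (x∈∁p⇒x∉p v∈A) paths

embed : ∀ {n} (c : Subset n) → Fin ∣ c ∣ → Fin n
embed (inside ∷ c)  zero    = zero
embed (inside ∷ c)  (suc i) = suc (embed c i)
embed (outside ∷ c) i       = suc (embed c i)

image : ∀ {n} (c : Subset n) → Subset ∣ c ∣ → Subset n
image []            B       = []
image (inside ∷ c)  (b ∷ B) = b ∷ image c B
image (outside ∷ c) B       = outside ∷ image c B

embed-injective : ∀ {n} (c : Subset n) → Injective _≡_ _≡_ (embed c)
embed-injective (inside ∷ c)  {zero}  {zero}  _  = refl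
embed-injective (inside ∷ c)  {suc i} {suc j} eq = cong suc (embed-injective c (suc-injective eq))
embed-injective (outside ∷ c)                 eq = embed-injective c (suc-injective eq)

embed-onto : ∀ {n} (c : Subset n) {x} → x ∈ c → ∃ λ i → embed c i ≡ x
embed-onto (inside ∷ c)  here      = zero , refl
embed-onto (inside ∷ c)  (there x∈c) = let i , eq = embed-onto c x∈c in suc i , cong suc eq
embed-onto (outside ∷ c) (there x∈c) = let i , eq = embed-onto c x∈c in i , cong suc eq

∈-image⁺ : ∀ {n} (c : Subset n) {B i} → i ∈ B → embed c i ∈ image c B
∈-image⁺ (inside ∷ c)  here      = here
∈-image⁺ (inside ∷ c)  (there i∈B) = there (∈-image⁺ c i∈B)
∈-image⁺ (outside ∷ c) i∈B       = there (∈-image⁺ c i∈B)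

∈-image⁻ : ∀ {n} (c : Subset n) {B x} → x ∈ image c B → ∃ λ i → i ∈ B × embed c i ≡ x
∈-image⁻ (inside ∷ c)  {inside ∷ B} here = zero , here , refl
∈-image⁻ (inside ∷ c)  {_ ∷ B} (there x∈) = let i , i∈B , eq = ∈-image⁻ c x∈ in suc i , there i∈B , cong suc eq
∈-image⁻ (outside ∷ c) (there x∈)         = let i , i∈B , eq = ∈-image⁻ c x∈ in i , i∈B , cong suc eq

∈-image-embed⁻ : ∀ {n} (c : Subset n) {B i} → embed c i ∈ image c B → i ∈ B
∈-image-embed⁻ c m = let j , j∈B , eq = ∈-image⁻ c m in subst (_∈ _) (embed-injective c eq) j∈B

image⊆ : ∀ {n} (c : Subset n) {B} → image c B ⊆ c
image⊆ (inside ∷ c)  {inside ∷ B} here = here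
image⊆ (inside ∷ c)  {_ ∷ B} (there x∈) = there (image⊆ c x∈)
image⊆ (outside ∷ c) (there x∈)         = there (image⊆ c x∈)

∣image∣≤∣B∣ : ∀ {n} (c : Subset n) B → ∣ image c B ∣ ≤ ∣ B ∣
∣image∣≤∣B∣ []            []            = z≤n
∣image∣≤∣B∣ (inside ∷ c)  (inside ∷ B)  = s≤s (∣image∣≤∣B∣ c B)
∣image∣≤∣B∣ (inside ∷ c)  (outside ∷ B) = ∣image∣≤∣B∣ c B
∣image∣≤∣B∣ (outside ∷ c) B             = ∣image∣≤∣B∣ c B

induced : ∀ {n} → Graph n → (c : Subset n) → Graph ∣ c ∣
induced G c = record { E = λ i j → E G (embed c i) (embed c j) ; E-sym = E-sym G ; E-irr = E-irr G }

module _ {n : ℕ} (G : Graph n) (c : Subset n) where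

  minorModel-lift : ∀ {m} {K : Graph m} → MinorModel K (induced G c) ⊤ → MinorModel K G c
  minorModel-lift M = record
    { branch    = λ i → image c (branch i)
    ; nonempty  = λ i → let x , x∈ = nonempty i in embed c x , ∈-image⁺ c x∈
    ; inside    = λ i → image⊆ c
    ; disjoint  = λ i j i≢j x x∈i x∈j →
        let a , a∈i , ea = ∈-image⁻ c x∈i in
        disjoint i j i≢j a a∈i (∈-image-embed⁻ c (subst (_∈ _) (sym ea) x∈j))
    ; connected = λ i x y x∈ y∈ →
        let a , a∈ , ea = ∈-image⁻ c x∈
            b , b∈ , eb = ∈-image⁻ c y∈
        in subst₂ (Walk G (_∈ image c (branch i))) ea eb
             (walk-map (embed c) (λ _ _ e → e) (∈-image⁺ c) (connected i a b a∈ b∈))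
    ; edges     = λ i j e → let x , y , x∈ , y∈ , exy = edges i j e in
        embed c x , embed c y , ∈-image⁺ c x∈ , ∈-image⁺ c y∈ , exy
    }
    where open MinorModel M

  minorFree-induced : ∀ F → MinorFree F G c → MinorFree F (induced G c) ⊤
  minorFree-induced F = All.map (λ no-model M → no-model (minorModel-lift M))

  treeDec-lift : ∀ {η} → TreeDec (induced G c) ⊤ η → TreeDec G c η
  treeDec-lift D = record
    { t = t ; T = T ; tree = tree
    ; bag       = λ i → image c (bag i)
    ; bagInside = λ i → image⊆ c
    ; width     = λ i → ≤-trans (∣image∣≤∣B∣ c (bag i)) (width i)
    ; vcover    = λ v v∈c →
        let a , ea = embed-onto c v∈c
            i , a∈i  = vcover a ∈⊤
        in i , ∈-image-at ea a∈i
    ; ecover    = λ u v u∈c v∈c e →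
        let a , ea = embed-onto c u∈c
            b , eb = embed-onto c v∈c
            i , a∈i , b∈i = ecover a b ∈⊤ ∈⊤ (subst₂ (E G) (sym ea) (sym eb) e)
        in i , ∈-image-at ea a∈i , ∈-image-at eb b∈i
    ; coherent  = coherence
    }
    where
    open TreeDec D
    ∈-image-at : ∀ {a x i} → embed c a ≡ x → a ∈ bag i → x ∈ image c (bag i)
    ∈-image-at refl a∈i = ∈-image⁺ c a∈i
    coherence : ∀ v → Connected T (λ i → v ∈ image c (bag i))
    coherence v i j v∈i v∈j with embed-onto c (image⊆ c v∈i)
    ... | a , refl = walk-map (λ z → z) (λ _ _ e → e) (∈-image⁺ c)
                       (coherent a i j (∈-image-embed⁻ c v∈i) (∈-image-embed⁻ c v∈j))

fDeletion⇒twDeletion : ∀ {F η} → (∀ m (H : Graph m) → MinorFree F H ⊤ → TreeDec H ⊤ η) →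
  ∀ {n} {G : Graph n} {S} → FDeletion F G S → TwDeletion η G S
fDeletion⇒twDeletion {F} twBound {G = G} {S} fS =
  treeDec-lift G (∁ S) (twBound _ (induced G (∁ S)) (minorFree-induced G (∁ S) F fS))

opt-mono : ∀ {ℓ ℓ′} {n} {P : Subset n → Set ℓ} {Q : Subset n → Set ℓ′} {k a b} →
  IsOpt P k a → IsOpt Q k b → (∀ S → P S → ∣ S ∣ ≤ k → Q S) → b ≤ a
opt-mono {k = k} {a} {b} ((S , PS , a≡) , _) ((S′ , _ , b≡) , b-min) P⇒Q with ∣ S ∣ ≤? k
... | yes small = subst (b ≤_) (sym a≡) (b-min S (P⇒Q S PS small))
... | no large  = begin
  b                 ≡⟨ b≡ ⟩
  ∣ S′ ∣ ⊓ suc k     ≤⟨ m⊓n≤n ∣ S′ ∣ (suc k) ⟩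
  suc k             ≡⟨ m≥n⇒m⊓n≡n (≰⇒> large) ⟨
  ∣ S ∣ ⊓ suc k      ≡⟨ a≡ ⟨
  a                 ∎
  where open ≤-Reasoning

lemma5p4 : (F : Family) (η : ℕ) (cX cZ : ℕ) →
    Any (λ mH → Planar (proj₂ mH)) F →
    (∀ m (H : Graph m) → MinorFree F H ⊤ → TreeDec H ⊤ η) →
    (n : ℕ) (G : Graph n) (k : ℕ) (X Z : Subset n) →
    (∀ x → x ∈ X → x ∉ Z) →
    ∣ X ∣ ≤ cX * k →
    ∣ Z ∣ ≤ cZ * k ^ 3 →
    FDeletion F G X →
    (∀ C → Component G (X ∪ Z) C →
      (∀ W → W ⊆ Z → (∀ w → w ∈ W → InNbr G C w) → ∣ W ∣ ≤ 2 * (η + 1)) ×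
      (∀ u v → u ∈ X → v ∈ X → InNbr G C u → InNbr G C v → u ≢ v →
        DisjPaths G (k + η + 2) u v)) →
    (Gflow : Graph n) →
    (∀ u v →
      (E Gflow u v →
        E G u v ⊎ (u ∈ X ∪ Z × v ∈ X ∪ Z × u ≢ v × DisjPaths G (k + η + 2) u v)) ×
      (E G u v ⊎ (u ∈ X ∪ Z × v ∈ X ∪ Z × u ≢ v × DisjPaths G (k + η + 2) u v) →
        E Gflow u v)) →
    (∀ a b → IsOpt (TwDeletion η G) k a → IsOpt (TwDeletion η Gflow) k b → a ≡ b) ×
    (∀ a b → IsOpt (FDeletion F G) k a → IsOpt (TwDeletion η Gflow) k b → b ≤ a)
lemma5p4 _ η _ _ _ twBound _ G k _ _ _ _ _ _ _ Gflow flow =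
    (λ _ _ optG optFlow → ≤-antisym (opt-mono optFlow optG (λ _ D _ → treeDec-subgraph G⊆Gflow D))
                                     (opt-mono optG optFlow addFlowEdges))
  , (λ _ _ optF optFlow → opt-mono optF optFlow (λ S fS → addFlowEdges S (fDeletion⇒twDeletion twBound fS)))
  where
  G⊆Gflow : ∀ {u v} → E G u v → E Gflow u v
  G⊆Gflow e = proj₂ (flow _ _) (inj₁ e)
  Gflow⊆G+flow : ∀ {u v} → E Gflow u v → E G u v ⊎ DisjPaths G (k + η + 2) u v
  Gflow⊆G+flow e with proj₁ (flow _ _) e
  ... | inj₁ eG                = inj₁ eG
  ... | inj₂ (_ , _ , _ , paths) = inj₂ paths
  addFlowEdges : ∀ S → TwDeletion η G S → ∣ S ∣ ≤ k → TwDeletion η Gflow S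
  addFlowEdges S D |S|≤k = treeDec-addFlowEdges Gflow⊆G+flow |S|≤k D
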